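{- Let $m,n>1$ be positive integers forming an interlocking pair, and suppose $d_2(n) < d_2(m)$, where $d_2(a)$ denotes the smallest prime divisor of $a$. If $n < m$, then $\tau(m) = \tau(n)$, and if $n > m$, then $\tau(m) = \tau(n) - 1$. Here $\tau(a)$ denotes the number of positive divisors of $a$.
   Context: Two positive integers $m$ and $n$ interlock (and $(m,n)$ is called an interlocking pair) if strictly between any two divisors of $n$ that are both larger than $1$ there lies a divisor of $m$, and strictly between any two divisors of $m$ that are both larger than $1$ there lies a divisor of $n$. -}

module Defs where

open import Data.Nat using (ℕ; suc; _<_; _≤_)
open import Data.Nat.Divisibility using (_∣_; _∣?_)
open import Data.Nat.Primality using (Prime)
open import Data.List using (List; filter; map; upTo; length)
open import Data.Product using (Σ; _×_; ∃-syntax)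

BetweenDivisors : ℕ → ℕ → Set
BetweenDivisors m n =
  ∀ a b → a ∣ n → b ∣ n → 1 < a → 1 < b → a < b →
  ∃[ c ] (c ∣ m × a < c × c < b)

Interlock : ℕ → ℕ → Set
Interlock m n = BetweenDivisors m n × BetweenDivisors n m

IsSmallestPrimeDivisor : ℕ → ℕ → Set
IsSmallestPrimeDivisor p a = Prime p × p ∣ a × (∀ q → Prime q → q ∣ a → p ≤ q)

divisors : ℕ → List ℕ
divisors a = filter (λ d → d ∣? a) (map suc (upTo a))

τ : ℕ → ℕ
τ a = length (divisors a)

-- Away from the common divisor 1, the divisors of n and m strictly alternate
-- on the number line, and the first one belongs to n since d₂(n) < d₂(m).
-- Scanning x upwards, n therefore has either as many divisors in [1, x] as m
-- or exactly one more, the latter precisely when the largest divisor of m ∪ n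
-- in [1, x] divides n. At x = max m n that largest divisor is max m n itself.
module Submission where

open import Defs
open import Data.Nat using (ℕ; _<_; _∸_)
open import Relation.Binary.PropositionalEquality using (_≡_)
open import Data.Product using (_×_)

open import Data.Nat.Base using (suc; zero; _≤_; _+_; z≤n; s≤s; nonTrivial⇒n>1; n>1⇒nonTrivial)
open import Data.Nat.Properties
open import Data.Nat.Divisibility using (_∣_; _∤_; _∣?_; ∣⇒≤; 1∣_; ∣-refl; ∣-trans)
open import Data.Nat.Primality using (Prime; prime?; ¬prime⇒composite; prime⇒nonTrivial; composite)
open import Data.Nat.Induction using (<-rec)
open import Data.List using ([]; _∷_; _++_; filter; map; upTo; length)
open import Data.List.Properties using (upTo-∷ʳ; map-++; length-++; filter-++; filter-accept; filter-reject)
open import Data.Product using (_,_; proj₁; proj₂; ∃-syntax)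
open import Data.Sum using (inj₁; inj₂)
open import Relation.Nullary using (yes; no; contradiction)
open import Relation.Binary.PropositionalEquality using (refl; sym; cong; subst; module ≡-Reasoning)

smallestPrimeDivisor≤divisor : ∀ {q a} → (∀ r → Prime r → r ∣ a → q ≤ r) →
                               ∀ d → 1 < d → d ∣ a → q ≤ d
smallestPrimeDivisor≤divisor {q} {a} minimal = <-rec (λ d → 1 < d → d ∣ a → q ≤ d) go
  where
  go : ∀ d → (∀ {e} → e < d → 1 < e → e ∣ a → q ≤ e) → 1 < d → d ∣ a → q ≤ d
  go d rec 1<d d∣a with prime? d
  ... | yes d-prime = minimal d d-prime d∣a
  ... | no ¬d-prime with ¬prime⇒composite {{n>1⇒nonTrivial 1<d}} ¬d-prime
  ... | composite {e} e<d e∣d =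
    ≤-trans (rec e<d (nonTrivial⇒n>1 e) (∣-trans e∣d d∣a)) (<⇒≤ e<d)

∣⇒≤-pos : ∀ {d a} → 1 ≤ a → d ∣ a → d ≤ a
∣⇒≤-pos {a = suc _} _ = ∣⇒≤

divisorCount≤ : ℕ → ℕ → ℕ
divisorCount≤ a x = length (filter (_∣? a) (map suc (upTo x)))

divisorCount≤-suc : ∀ a x →
  divisorCount≤ a (suc x) ≡ divisorCount≤ a x + length (filter (_∣? a) (suc x ∷ []))
divisorCount≤-suc a x = begin
  length (filter (_∣? a) (map suc (upTo (suc x))))
    ≡⟨ cong (λ l → length (filter (_∣? a) (map suc l))) (sym (upTo-∷ʳ x)) ⟩
  length (filter (_∣? a) (map suc (upTo x ++ x ∷ [])))
    ≡⟨ cong (λ l → length (filter (_∣? a) l)) (map-++ suc (upTo x) (x ∷ [])) ⟩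
  length (filter (_∣? a) (map suc (upTo x) ++ suc x ∷ []))
    ≡⟨ cong length (filter-++ (_∣? a) (map suc (upTo x)) (suc x ∷ [])) ⟩
  length (filter (_∣? a) (map suc (upTo x)) ++ filter (_∣? a) (suc x ∷ []))
    ≡⟨ length-++ (filter (_∣? a) (map suc (upTo x))) ⟩
  divisorCount≤ a x + length (filter (_∣? a) (suc x ∷ [])) ∎
  where open ≡-Reasoning

divisorCount≤-suc-∣ : ∀ a x → suc x ∣ a → divisorCount≤ a (suc x) ≡ suc (divisorCount≤ a x)
divisorCount≤-suc-∣ a x x+1∣a = begin
  divisorCount≤ a (suc x)                                    ≡⟨ divisorCount≤-suc a x ⟩
  divisorCount≤ a x + length (filter (_∣? a) (suc x ∷ []))
    ≡⟨ cong (λ l → divisorCount≤ a x + length l) (filter-accept (_∣? a) {xs = []} x+1∣a) ⟩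
  divisorCount≤ a x + 1                                      ≡⟨ +-comm (divisorCount≤ a x) 1 ⟩
  suc (divisorCount≤ a x)                                    ∎
  where open ≡-Reasoning

divisorCount≤-suc-∤ : ∀ a x → suc x ∤ a → divisorCount≤ a (suc x) ≡ divisorCount≤ a x
divisorCount≤-suc-∤ a x x+1∤a = begin
  divisorCount≤ a (suc x)                                    ≡⟨ divisorCount≤-suc a x ⟩
  divisorCount≤ a x + length (filter (_∣? a) (suc x ∷ []))
    ≡⟨ cong (λ l → divisorCount≤ a x + length l) (filter-reject (_∣? a) {xs = []} x+1∤a) ⟩
  divisorCount≤ a x + 0                                      ≡⟨ +-identityʳ (divisorCount≤ a x) ⟩
  divisorCount≤ a x                                          ∎
  where open ≡-Reasoning

divisorCount≤-beyond : ∀ a x → 1 ≤ a → a ≤ x → divisorCount≤ a x ≡ τ a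
divisorCount≤-beyond (suc a) zero _ ()
divisorCount≤-beyond a (suc x) 1≤a a≤x+1 with m≤n⇒m<n∨m≡n a≤x+1
... | inj₂ refl       = refl
... | inj₁ (s≤s a≤x) = begin
  divisorCount≤ a (suc x) ≡⟨ divisorCount≤-suc-∤ a x (λ x+1∣a → <⇒≱ (s≤s a≤x) (∣⇒≤-pos 1≤a x+1∣a)) ⟩
  divisorCount≤ a x       ≡⟨ divisorCount≤-beyond a x 1≤a a≤x ⟩
  τ a                     ∎
  where open ≡-Reasoning

largestDivisor≤ : ℕ → ℕ → ℕ
largestDivisor≤ a zero = 0
largestDivisor≤ a (suc x) with suc x ∣? a
... | yes _ = suc x
... | no _  = largestDivisor≤ a x

largestDivisor≤-suc-∣ : ∀ a x → suc x ∣ a → largestDivisor≤ a (suc x) ≡ suc x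
largestDivisor≤-suc-∣ a x x+1∣a with suc x ∣? a
... | yes _     = refl
... | no x+1∤a = contradiction x+1∣a x+1∤a

largestDivisor≤-∣ : ∀ a x → largestDivisor≤ a (suc x) ∣ a
largestDivisor≤-∣ a zero with 1 ∣? a
... | yes 1∣a = 1∣a
... | no 1∤a  = contradiction (1∣ a) 1∤a
largestDivisor≤-∣ a (suc x) with suc (suc x) ∣? a
... | yes x+2∣a = x+2∣a
... | no _      = largestDivisor≤-∣ a x

largestDivisor≤-≤ : ∀ a x → largestDivisor≤ a x ≤ x
largestDivisor≤-≤ a zero = z≤n
largestDivisor≤-≤ a (suc x) with suc x ∣? a
... | yes _ = ≤-refl
... | no _  = m≤n⇒m≤1+n (largestDivisor≤-≤ a x)

largestDivisor≤-maximal : ∀ a x d → d ∣ a → d ≤ x → d ≤ largestDivisor≤ a x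
largestDivisor≤-maximal a zero .zero _ z≤n = z≤n
largestDivisor≤-maximal a (suc x) d d∣a d≤x+1 with suc x ∣? a
... | yes _ = d≤x+1
... | no x+1∤a with m≤n⇒m<n∨m≡n d≤x+1
...   | inj₁ (s≤s d≤x) = largestDivisor≤-maximal a x d d∣a d≤x
...   | inj₂ refl      = contradiction d∣a x+1∤a

largestDivisor≤-self : ∀ a → largestDivisor≤ a a ≡ a
largestDivisor≤-self zero    = refl
largestDivisor≤-self (suc a) = largestDivisor≤-suc-∣ (suc a) a ∣-refl

largestDivisor≤-≤-self : ∀ a x → 1 ≤ a → 1 ≤ x → largestDivisor≤ a x ≤ a
largestDivisor≤-≤-self a (suc x) 1≤a _ = ∣⇒≤-pos 1≤a (largestDivisor≤-∣ a x)

largestDivisor≤-pos : ∀ a x → 1 ≤ largestDivisor≤ a (suc x)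
largestDivisor≤-pos a x = largestDivisor≤-maximal a (suc x) 1 (1∣ a) (s≤s z≤n)

Leads : ℕ → ℕ → Set
Leads n m = ∀ b → b ∣ m → 1 < b → ∃[ c ] (c ∣ n × 1 < c × c < b)

smallerSmallestPrime⇒leads : ∀ {m n p q} → IsSmallestPrimeDivisor p n → IsSmallestPrimeDivisor q m →
                             p < q → Leads n m
smallerSmallestPrime⇒leads {p = p} (p-prime , p∣n , _) (_ , _ , q-minimal) p<q b b∣m 1<b =
  p , p∣n , nonTrivial⇒n>1 p {{prime⇒nonTrivial p-prime}} ,
  <-≤-trans p<q (smallestPrimeDivisor≤divisor q-minimal b 1<b b∣m)

-- The state of the scan: ln, lm are the largest divisors of n, m found so far
-- and cn, cm the numbers of divisors found so far.
data Phase (ln lm cn cm : ℕ) : Set where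
  balanced : ln ≤ lm → cn ≡ cm → Phase ln lm cn cm
  nAhead   : lm < ln → cn ≡ suc cm → Phase ln lm cn cm

module Alternation (m n : ℕ) (interlock : Interlock m n) (leads : Leads n m) where

  PhaseAt : ℕ → Set
  PhaseAt x = Phase (largestDivisor≤ n x) (largestDivisor≤ m x) (divisorCount≤ n x) (divisorCount≤ m x)

  private
    Lₙ Lₘ : ℕ → ℕ
    Lₙ = largestDivisor≤ n
    Lₘ = largestDivisor≤ m

  nAhead⇒next∤n : ∀ x → Lₘ (suc x) < Lₙ (suc x) → suc (suc x) ∤ n
  nAhead⇒next∤n x Lₘ<Lₙ x+2∣n
    with proj₁ interlock (Lₙ (suc x)) (suc (suc x)) (largestDivisor≤-∣ n x) x+2∣n
           (≤-<-trans (largestDivisor≤-pos m x) Lₘ<Lₙ) (s≤s (s≤s z≤n)) (s≤s (largestDivisor≤-≤ n (suc x)))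
  ... | c , c∣m , Lₙ<c , s≤s c≤x+1 =
    <⇒≱ (<-trans Lₘ<Lₙ Lₙ<c) (largestDivisor≤-maximal m (suc x) c c∣m c≤x+1)

  nDivisorBefore-mDivisor : ∀ x → suc (suc x) ∣ m →
                            ∃[ c ] (c ∣ n × Lₘ (suc x) < c × c < suc (suc x))
  nDivisorBefore-mDivisor x x+2∣m with m≤n⇒m<n∨m≡n (largestDivisor≤-pos m x)
  ... | inj₁ 1<Lₘ = proj₂ interlock (Lₘ (suc x)) (suc (suc x)) (largestDivisor≤-∣ m x) x+2∣m
                      1<Lₘ (s≤s (s≤s z≤n)) (s≤s (largestDivisor≤-≤ m (suc x)))
  ... | inj₂ 1≡Lₘ with leads (suc (suc x)) x+2∣m (s≤s (s≤s z≤n))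
  ...   | c , c∣n , 1<c , c<x+2 = c , c∣n , subst (_< c) 1≡Lₘ 1<c , c<x+2

  balanced⇒next∤m : ∀ x → Lₙ (suc x) ≤ Lₘ (suc x) → suc (suc x) ∤ m
  balanced⇒next∤m x Lₙ≤Lₘ x+2∣m with nDivisorBefore-mDivisor x x+2∣m
  ... | c , c∣n , Lₘ<c , s≤s c≤x+1 =
    <⇒≱ (≤-<-trans Lₙ≤Lₘ Lₘ<c) (largestDivisor≤-maximal n (suc x) c c∣n c≤x+1)

  -- Matching on suc (suc x) ∣? n and ∣? m also unfolds largestDivisor≤ in the goal,
  -- so only the counts need rewriting.
  phaseAt-suc : ∀ x → PhaseAt (suc x) → PhaseAt (suc (suc x))
  phaseAt-suc x (balanced Lₙ≤Lₘ eq) with suc (suc x) ∣? n | suc (suc x) ∣? m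
  ... | _ | yes x+2∣m = contradiction x+2∣m (balanced⇒next∤m x Lₙ≤Lₘ)
  ... | yes x+2∣n | no x+2∤m
    rewrite divisorCount≤-suc-∣ n (suc x) x+2∣n | divisorCount≤-suc-∤ m (suc x) x+2∤m
    = nAhead (s≤s (largestDivisor≤-≤ m (suc x))) (cong suc eq)
  ... | no x+2∤n | no x+2∤m
    rewrite divisorCount≤-suc-∤ n (suc x) x+2∤n | divisorCount≤-suc-∤ m (suc x) x+2∤m
    = balanced Lₙ≤Lₘ eq
  phaseAt-suc x (nAhead Lₘ<Lₙ eq) with suc (suc x) ∣? n | suc (suc x) ∣? m
  ... | yes x+2∣n | _ = contradiction x+2∣n (nAhead⇒next∤n x Lₘ<Lₙ)
  ... | no x+2∤n | yes x+2∣m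
    rewrite divisorCount≤-suc-∤ n (suc x) x+2∤n | divisorCount≤-suc-∣ m (suc x) x+2∣m
    = balanced (m≤n⇒m≤1+n (largestDivisor≤-≤ n (suc x))) eq
  ... | no x+2∤n | no x+2∤m
    rewrite divisorCount≤-suc-∤ n (suc x) x+2∤n | divisorCount≤-suc-∤ m (suc x) x+2∤m
    = nAhead Lₘ<Lₙ eq

  phaseAt : ∀ x → PhaseAt (suc x)
  phaseAt zero
    rewrite largestDivisor≤-suc-∣ n 0 (1∣ n) | largestDivisor≤-suc-∣ m 0 (1∣ m)
          | divisorCount≤-suc-∣ n 0 (1∣ n) | divisorCount≤-suc-∣ m 0 (1∣ m)
    = balanced ≤-refl refl
  phaseAt (suc x) = phaseAt-suc x (phaseAt x)

  phaseAt-pos : ∀ x → 1 ≤ x → PhaseAt x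
  phaseAt-pos (suc x) _ = phaseAt x

  τ-of-n<m : 1 < n → n < m → τ m ≡ τ n
  τ-of-n<m 1<n n<m with phaseAt-pos m (<⇒≤ (<-trans 1<n n<m))
  ... | balanced _ eq = begin
    τ m               ≡⟨ sym eq ⟩
    divisorCount≤ n m ≡⟨ divisorCount≤-beyond n m (<⇒≤ 1<n) (<⇒≤ n<m) ⟩
    τ n               ∎
    where open ≡-Reasoning
  ... | nAhead Lₘ<Lₙ _ = contradiction (begin-strict
    m      ≡⟨ sym (largestDivisor≤-self m) ⟩
    Lₘ m   <⟨ Lₘ<Lₙ ⟩
    Lₙ m   ≤⟨ largestDivisor≤-≤-self n m (<⇒≤ 1<n) (<⇒≤ (<-trans 1<n n<m)) ⟩
    n      <⟨ n<m ⟩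
    m      ∎) (<-irrefl refl)
    where open ≤-Reasoning

  τ-of-m<n : 1 < m → m < n → τ m ≡ τ n ∸ 1
  τ-of-m<n 1<m m<n with phaseAt-pos n (<⇒≤ (<-trans 1<m m<n))
  ... | nAhead _ eq = sym (cong (_∸ 1) (begin
    τ n                     ≡⟨ eq ⟩
    suc (divisorCount≤ m n) ≡⟨ cong suc (divisorCount≤-beyond m n (<⇒≤ 1<m) (<⇒≤ m<n)) ⟩
    suc (τ m)               ∎))
    where open ≡-Reasoning
  ... | balanced Lₙ≤Lₘ _ = contradiction (begin-strict
    n      ≡⟨ sym (largestDivisor≤-self n) ⟩
    Lₙ n   ≤⟨ Lₙ≤Lₘ ⟩
    Lₘ n   ≤⟨ largestDivisor≤-≤-self m n (<⇒≤ 1<m) (<⇒≤ (<-trans 1<m m<n)) ⟩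
    m      <⟨ m<n ⟩
    n      ∎) (<-irrefl refl)
    where open ≤-Reasoning

mainTheorem1 : ∀ (m n p q : ℕ) → 1 < m → 1 < n → Interlock m n →
    IsSmallestPrimeDivisor p n → IsSmallestPrimeDivisor q m → p < q →
    (n < m → τ m ≡ τ n) × (m < n → τ m ≡ τ n ∸ 1)
mainTheorem1 m n p q 1<m 1<n interlock p-smallest q-smallest p<q =
  τ-of-n<m 1<n , τ-of-m<n 1<m
  where open Alternation m n interlock (smallerSmallestPrime⇒leads p-smallest q-smallest p<q)
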